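{- Let $G=(X,E)$ be a finite connected undirected graph with real edge costs $\mathrm{cost}: E\to\mathbb{R}$, and let $T$ be a minimum spanning tree of $G$. Let $\{i,j\}\in E$ be a nontree edge of $T$, and let $T_{\{i,j\}}$ be the spanning tree obtained from $T$ by removing the edge $\text{r-edge}(T,\{i,j\})$ (computed with no imposed edges) and adding the edge $\{i,j\}$; this is a minimum-cost spanning tree of $G$ among those containing $\{i,j\}$, and in it $\{i,j\}$ is considered imposed. Then for every edge $\{k,l\}\in E$ with $\{k,l\}\notin T$ and $\{k,l\}\neq\{i,j\}$, $$\text{r-cost}(T_{\{i,j\}},\{k,l\}) \;\geq\; \text{r-cost}(T,\{k,l\}),$$ where the replacement cost in $T$ is computed with no imposed edges and the replacement cost in $T_{\{i,j\}}$ is computed with $\{i,j\}$ as the only imposed edge.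
   Context: A spanning tree $S$ of $G$ is a tree with vertex set $X$ and edge set contained in $E$; its edges are tree edges and the edges of $E$ not in $S$ are nontree edges. A minimum spanning tree minimizes the sum of its edge costs. "Imposed" edges form a set $J\subseteq E$ of edges that must belong to the spanning tree. For a spanning tree $S$ with imposed set $J\subseteq S$ and a nontree edge $\{k,l\}$ of $S$, let $P(S,k,l)$ be the set of edges of the unique simple path from $k$ to $l$ in $S$. The replacement edge $\text{r-edge}(S,\{k,l\})$ is an edge of maximum cost among the edges of $P(S,k,l)$ that are not in $J$, and the replacement cost is $\text{r-cost}(S,\{k,l\})=\mathrm{cost}(\{k,l\})-\mathrm{cost}(\text{r-edge}(S,\{k,l\}))$. If every edge of $P(S,k,l)$ belongs to $J$ (no replacement edge exists), the replacement cost is defined to be $+\infty$. -}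

module Defs where

open import Level using (Level; _⊔_) renaming (suc to lsuc)
open import Data.Nat using (ℕ; zero; suc)
open import Data.Fin using (Fin; zero; suc)
open import Data.Fin.Subset using (Subset; _∈_; _∉_; outside; inside)
open import Data.Vec using ([]; _∷_)
open import Data.Bool using (Bool; true; false; if_then_else_)
open import Data.List using (List; []; _∷_)
open import Data.List.Relation.Unary.All using (All)
open import Data.List.Relation.Unary.Unique.Propositional using (Unique)
open import Data.List.Membership.Propositional using () renaming (_∈_ to _∈ₗ_)
open import Data.Product using (Σ; _×_; _,_)
open import Data.Sum using (_⊎_)
open import Relation.Nullary using (¬_)
open import Relation.Binary.PropositionalEquality using (_≡_; _≢_)
open import Relation.Binary.Core using (Rel)
open import Relation.Binary.Structures using (IsTotalOrder)
open import Algebra.Bundles using (AbelianGroup)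

-- Cost domain: a totally ordered abelian group (the reals are one).

record OrderedAbelianGroup (c ℓ₁ ℓ₂ : Level) : Set (lsuc (c ⊔ ℓ₁ ⊔ ℓ₂)) where
  field
    abelianGroup : AbelianGroup c ℓ₁
  open AbelianGroup abelianGroup public
  infix 4 _≤_
  field
    _≤_          : Rel Carrier ℓ₂
    isTotalOrder : IsTotalOrder _≈_ _≤_
    ∙-monoˡ-≤    : ∀ {x y} z → x ≤ y → (x ∙ z) ≤ (y ∙ z)

  _⊖_ : Carrier → Carrier → Carrier
  x ⊖ y = x ∙ (y ⁻¹)

-- Finite simple undirected graphs: vertices Fin n, edges Fin m,
-- edge e has the (unordered) endpoint pair {src e , tgt e}.

record Graph : Set where
  field
    n   : ℕ
    m   : ℕ
    src : Fin m → Fin n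
    tgt : Fin m → Fin n
    loopless : ∀ e → src e ≢ tgt e
    simple   : ∀ e e′ → e ≢ e′ →
               ¬ ((src e ≡ src e′ × tgt e ≡ tgt e′) ⊎ (src e ≡ tgt e′ × tgt e ≡ src e′))

module _ (G : Graph) where
  open Graph G

  Joins : Fin m → Fin n → Fin n → Set
  Joins e u w = (src e ≡ u × tgt e ≡ w) ⊎ (src e ≡ w × tgt e ≡ u)

  data Walk : Fin n → Fin n → Set where
    []   : ∀ {u} → Walk u u
    step : ∀ {u w v} (e : Fin m) → Joins e u w → Walk w v → Walk u v

  edges : ∀ {u v} → Walk u v → List (Fin m)
  edges []             = []
  edges (step e _ p)   = e ∷ edges p

  vertices : ∀ {u v} → Walk u v → List (Fin n)
  vertices {u} []           = u ∷ []
  vertices {u} (step e _ p) = u ∷ vertices p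

  IsPath : ∀ {u v} → Walk u v → Set
  IsPath p = Unique (vertices p)

  Within : Subset m → ∀ {u v} → Walk u v → Set
  Within S p = All (_∈ S) (edges p)

  Connects : Subset m → Set
  Connects S = ∀ u v → Σ (Walk u v) (λ p → Within S p)

  -- S contains no cycle: no edge e ∈ S whose endpoints are joined by a
  -- simple path in S avoiding e (such a path plus e would be a cycle)
  Acyclic : Subset m → Set
  Acyclic S = ¬ Σ (Fin m) (λ e → e ∈ S × Σ (Walk (src e) (tgt e))
                 (λ p → IsPath p × Within S p × ¬ (e ∈ₗ edges p)))

  IsSpanningTree : Subset m → Set
  IsSpanningTree S = Connects S × Acyclic S

  ConnectedGraph : Set
  ConnectedGraph = ∀ u v → Walk u v

  module Costs {c ℓ₁ ℓ₂} (O : OrderedAbelianGroup c ℓ₁ ℓ₂)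
               (cost : Fin m → OrderedAbelianGroup.Carrier O) where
    open OrderedAbelianGroup O

    sumOver : ∀ {k} → Subset k → (Fin k → Carrier) → Carrier
    sumOver []            f = ε
    sumOver (b ∷ S) f = (if b then f zero else ε) ∙ sumOver S (λ i → f (suc i))

    totalCost : Subset m → Carrier
    totalCost S = sumOver S cost

    IsMST : Subset m → Set ℓ₂
    IsMST S = IsSpanningTree S × (∀ S′ → IsSpanningTree S′ → totalCost S ≤ totalCost S′)

    IsREdgeOn : Subset m → ∀ {u v} → Walk u v → Fin m → Set (ℓ₂)
    IsREdgeOn J p r = r ∈ₗ edges p × r ∉ J ×
                      (∀ r′ → r′ ∈ₗ edges p → r′ ∉ J → cost r′ ≤ cost r)

    IsREdge : Subset m → Subset m → Fin m → Fin m → Set ℓ₂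
    IsREdge S J e r = Σ (Walk (src e) (tgt e))
                        (λ p → IsPath p × Within S p × IsREdgeOn J p r)

    data Ext : Set c where
      fin : Carrier → Ext
      ∞   : Ext

    infix 4 _≤ₑ_
    data _≤ₑ_ : Ext → Ext → Set (c ⊔ ℓ₂) where
      fin≤fin : ∀ {x y} → x ≤ y → fin x ≤ₑ fin y
      ≤∞      : ∀ {x} → x ≤ₑ ∞

    data HasRCost (S J : Subset m) (e : Fin m) : Ext → Set (c ⊔ ℓ₂) where
      finite   : ∀ r → IsREdge S J e r → HasRCost S J e (fin (cost e ⊖ cost r))
      infinite : (p : Walk (src e) (tgt e)) → IsPath p → Within S p →
                 All (_∈ J) (edges p) → HasRCost S J e ∞

-- In a forest every edge of a simple path lies on every walk with the same
-- ends.  So an edge x ≠ ij of the path P′ of kl in T′ = T - r + ij lies on the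
-- path P of kl in T, unless P′ uses ij.  In that case x lies on P or on the
-- cycle C = P(T, i, j), and r lies on P: cutting P′ at ij and closing it with
-- P gives a walk parallel to C, which must contain r, and only P can supply it.
-- Since r is a maximum of C, either way cost x ≤ max P.
module Submission where

open import Defs
open import Level using (Level)
open import Data.Fin using (Fin)
open import Data.Fin.Properties using (_≟_)
open import Data.Fin.Subset using (Subset; _∈_; _∉_; ⁅_⁆; _∪_; _-_; _─_; ⊥; outside)
open import Data.Fin.Subset.Properties
  using (∉⊥; x∈⁅x⁆; x∈⁅y⁆⇒x≡y; x∈p∪q⁺; x∈p∪q⁻; p─q⊆p)
open import Data.Vec using (_∷_)
import Data.Vec.Base as Vec
open import Data.List as List using (List; []; _∷_; _++_)
open import Data.List.Properties using (unfold-reverse)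
open import Data.List.Relation.Unary.Any using (here; there; any?)
open import Data.List.Relation.Unary.Any.Properties using (reverse⁻)
open import Data.List.Relation.Unary.All as All using (All; []; _∷_)
open import Data.List.Relation.Unary.All.Properties using (¬Any⇒All¬; All¬⇒¬Any; anti-mono)
import Data.List.Relation.Unary.All.Properties as Allₚ
open import Data.List.Relation.Unary.AllPairs using ([]; _∷_)
open import Data.List.Relation.Unary.Unique.Propositional using (Unique)
open import Data.List.Membership.Propositional using () renaming (_∈_ to _∈ₗ_; _∉_ to _∉ₗ_)
open import Data.List.Membership.Propositional.Properties using (∈-++⁺ʳ; ∈-++⁻)
open import Data.List.Relation.Binary.Subset.Propositional using () renaming (_⊆_ to _⊆ₗ_)
open import Data.List.Relation.Binary.Subset.Propositional.Properties using (∈-∷⁺ʳ)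
open import Data.Product as Product using (Σ; _×_; _,_; proj₁; proj₂)
open import Data.Sum as Sum using (_⊎_; inj₁; inj₂; [_,_])
open import Data.Empty using (⊥-elim)
open import Function using (_∘_; id)
open import Relation.Nullary using (Dec; yes; no; contradiction)
open import Relation.Binary.Bundles using (Poset)
open import Relation.Binary.PropositionalEquality using (_≡_; _≢_; refl; sym; cong; subst)
open import Relation.Binary.Structures using (IsTotalOrder)
import Relation.Binary.Reasoning.PartialOrder as PosetReasoning

x∈p─q⇒x∉q : ∀ {k} {p q : Subset k} {x} → x ∈ p ─ q → x ∉ q
x∈p─q⇒x∉q {p = _ ∷ _} {outside ∷ _} Vec.here ()
x∈p─q⇒x∉q {p = _ ∷ _} {_ ∷ _} (Vec.there x∈p─q) (Vec.there x∈q) = x∈p─q⇒x∉q x∈p─q x∈q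

∈-∪⁅⁆⁻ : ∀ {k} {p : Subset k} {x y} → x ∈ p ∪ ⁅ y ⁆ → x ≢ y → x ∈ p
∈-∪⁅⁆⁻ {p = p} {y = y} x∈p∪y x≢y =
  [ id , (λ x∈⁅y⁆ → contradiction (x∈⁅y⁆⇒x≡y y x∈⁅y⁆) x≢y) ] (x∈p∪q⁻ p ⁅ y ⁆ x∈p∪y)

∈-++⁻ʳ-∉ : ∀ {a} {A : Set a} xs {ys} {x : A} → x ∈ₗ xs ++ ys → x ∉ₗ xs → x ∈ₗ ys
∈-++⁻ʳ-∉ xs x∈xs++ys x∉xs = [ (λ x∈xs → contradiction x∈xs x∉xs) , id ] (∈-++⁻ xs x∈xs++ys)

Unique-middle⁻ : ∀ {a} {A : Set a} xs {x : A} {ys} → Unique (xs ++ x ∷ ys) → x ∉ₗ xs × x ∉ₗ ys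
Unique-middle⁻ []        (x∉ys ∷ _) = (λ ()) , All¬⇒¬Any x∉ys
Unique-middle⁻ (x′ ∷ xs) (x′∉ ∷ xs!) =
  (λ { (here refl) → All.lookup x′∉ (∈-++⁺ʳ xs (here refl)) refl
     ; (there x∈xs) → proj₁ (Unique-middle⁻ xs xs!) x∈xs })
  , proj₂ (Unique-middle⁻ xs xs!)

_∈?_ : ∀ {k} (x : Fin k) (xs : List (Fin k)) → Dec (x ∈ₗ xs)
x ∈? xs = any? (x ≟_) xs

module OrderedAbelianGroupProperties {c ℓ₁ ℓ₂} (O : OrderedAbelianGroup c ℓ₁ ℓ₂) where
  open OrderedAbelianGroup O
  open import Algebra.Properties.Group group using (\\-leftDividesˡ)

  poset : Poset c ℓ₁ ℓ₂
  poset = record { isPartialOrder = IsTotalOrder.isPartialOrder isTotalOrder }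

  open PosetReasoning poset
  open Poset poset public using () renaming (trans to ≤-trans)

  ⁻¹-mono-≤ : ∀ {x y} → x ≤ y → y ⁻¹ ≤ x ⁻¹
  ⁻¹-mono-≤ {x} {y} x≤y = begin
    y ⁻¹                ≈⟨ \\-leftDividesˡ x (y ⁻¹) ⟨
    x ∙ (x ⁻¹ ∙ y ⁻¹)   ≤⟨ ∙-monoˡ-≤ (x ⁻¹ ∙ y ⁻¹) x≤y ⟩
    y ∙ (x ⁻¹ ∙ y ⁻¹)   ≈⟨ ∙-congˡ (comm (x ⁻¹) (y ⁻¹)) ⟩
    y ∙ (y ⁻¹ ∙ x ⁻¹)   ≈⟨ \\-leftDividesˡ y (x ⁻¹) ⟩
    x ⁻¹                ∎

  ⊖-monoʳ-≤ : ∀ {x y} z → x ≤ y → z ⊖ y ≤ z ⊖ x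
  ⊖-monoʳ-≤ {x} {y} z x≤y = begin
    z ∙ y ⁻¹   ≈⟨ comm z (y ⁻¹) ⟩
    y ⁻¹ ∙ z   ≤⟨ ∙-monoˡ-≤ z (⁻¹-mono-≤ x≤y) ⟩
    x ⁻¹ ∙ z   ≈⟨ comm (x ⁻¹) z ⟩
    z ∙ x ⁻¹   ∎

module WalkProperties (G : Graph) where
  open Graph G

  private variable
    u v w w′ : Fin n
    e x : Fin m
    S : Subset m

  Joins-sym : Joins G e u w → Joins G e w u
  Joins-sym (inj₁ (s≡u , t≡w)) = inj₂ (s≡u , t≡w)
  Joins-sym (inj₂ (s≡w , t≡u)) = inj₁ (s≡w , t≡u)

  infixr 5 _++ᵂ_
  _++ᵂ_ : Walk G u w → Walk G w v → Walk G u v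
  []         ++ᵂ q = q
  step e j p ++ᵂ q = step e j (p ++ᵂ q)

  edges-++ᵂ : (p : Walk G u w) (q : Walk G w v) → edges G (p ++ᵂ q) ≡ edges G p ++ edges G q
  edges-++ᵂ []           q = refl
  edges-++ᵂ (step e j p) q = cong (e ∷_) (edges-++ᵂ p q)

  ∈-++ᵂ⁻ : (p : Walk G u w) {q : Walk G w v} →
           x ∈ₗ edges G (p ++ᵂ q) → x ∈ₗ edges G p ⊎ x ∈ₗ edges G q
  ∈-++ᵂ⁻ {x = x} p {q} = ∈-++⁻ (edges G p) ∘ subst (x ∈ₗ_) (edges-++ᵂ p q)

  Within-++ᵂ : {p : Walk G u w} {q : Walk G w v} →
               Within G S p → Within G S q → Within G S (p ++ᵂ q)
  Within-++ᵂ {S = S} {p = p} {q} p-within q-within =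
    subst (All (_∈ S)) (sym (edges-++ᵂ p q)) (Allₚ.++⁺ p-within q-within)

  reverse : Walk G u v → Walk G v u
  reverse []           = []
  reverse (step e j p) = reverse p ++ᵂ step e (Joins-sym j) []

  edges-reverse : (p : Walk G u v) → edges G (reverse p) ≡ List.reverse (edges G p)
  edges-reverse []           = refl
  edges-reverse (step e j p) rewrite edges-++ᵂ (reverse p) (step e (Joins-sym j) [])
                                   | edges-reverse p
    = sym (unfold-reverse e (edges G p))

  ∈-reverse⁻ : (p : Walk G u v) → edges G (reverse p) ⊆ₗ edges G p
  ∈-reverse⁻ p = reverse⁻ ∘ subst (_ ∈ₗ_) (edges-reverse p)

  Within-reverse : (p : Walk G u v) → Within G S p → Within G S (reverse p)
  Within-reverse p = anti-mono (∈-reverse⁻ p)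

  reorient : Joins G e u w → ∀ {u′ w′} → Joins G e u′ w′ → (p : Walk G u w) →
             Σ (Walk G u′ w′) λ p′ → edges G p′ ⊆ₗ edges G p
  reorient (inj₁ (refl , refl)) (inj₁ (refl , refl)) p = p , id
  reorient (inj₁ (refl , refl)) (inj₂ (refl , refl)) p = reverse p , ∈-reverse⁻ p
  reorient (inj₂ (refl , refl)) (inj₁ (refl , refl)) p = reverse p , ∈-reverse⁻ p
  reorient (inj₂ (refl , refl)) (inj₂ (refl , refl)) p = p , id

  Joins-src-tgt : Joins G e (src e) (tgt e)
  Joins-src-tgt = inj₁ (refl , refl)

  Within⊥⇒≡ : (p : Walk G u v) → Within G ⊥ p → u ≡ v
  Within⊥⇒≡ []           _         = refl
  Within⊥⇒≡ (step _ _ _) (e∈⊥ ∷ _) = ⊥-elim (∉⊥ e∈⊥)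

  head∈vertices : (p : Walk G u v) → u ∈ₗ vertices G p
  head∈vertices []           = here refl
  head∈vertices (step _ _ _) = here refl

  endpoints∈vertices : (p : Walk G u v) → e ∈ₗ edges G p →
                       src e ∈ₗ vertices G p × tgt e ∈ₗ vertices G p
  endpoints∈vertices (step _ (inj₁ (refl , refl)) p) (here refl) =
    here refl , there (head∈vertices p)
  endpoints∈vertices (step _ (inj₂ (refl , refl)) p) (here refl) =
    there (head∈vertices p) , here refl
  endpoints∈vertices (step _ _ p) (there e∈p) = Product.map there there (endpoints∈vertices p e∈p)

  first-edge∉rest : (j : Joins G e u w) (p : Walk G w v) → IsPath G (step e j p) → e ∉ₗ edges G p
  first-edge∉rest (inj₁ (refl , _)) p (u∉p ∷ _) e∈p =
    All.lookup u∉p (proj₁ (endpoints∈vertices p e∈p)) refl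
  first-edge∉rest (inj₂ (_ , refl)) p (u∉p ∷ _) e∈p =
    All.lookup u∉p (proj₂ (endpoints∈vertices p e∈p)) refl

  IsPath⇒Unique-edges : (p : Walk G u v) → IsPath G p → Unique (edges G p)
  IsPath⇒Unique-edges []           _                 = []
  IsPath⇒Unique-edges (step e j p) p-path@(_ ∷ rest) =
    ¬Any⇒All¬ (edges G p) (first-edge∉rest j p p-path) ∷ IsPath⇒Unique-edges p rest

  suffix : (p : Walk G w v) → IsPath G p → u ∈ₗ vertices G p →
           Σ (Walk G u v) λ q → IsPath G q × edges G q ⊆ₗ edges G p
  suffix []           p-path       (here refl) = [] , p-path , id
  suffix (step e j p) p-path       (here refl) = step e j p , p-path , id
  suffix (step e j p) (_ ∷ p-path) (there u∈p) with suffix p p-path u∈p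
  ... | q , q-path , q⊆p = q , q-path , there ∘ q⊆p

  walk⇒path : (p : Walk G u v) → Σ (Walk G u v) λ q → IsPath G q × edges G q ⊆ₗ edges G p
  walk⇒path []                     = [] , [] ∷ [] , id
  walk⇒path {u = u} (step e j p) with walk⇒path p
  ... | q , q-path , q⊆p with u ∈? vertices G q
  ...   | yes u∈q = let (q′ , q′-path , q′⊆q) = suffix q q-path u∈q in
                    q′ , q′-path , there ∘ q⊆p ∘ q′⊆q
  ...   | no  u∉q = step e j q , ¬Any⇒All¬ _ u∉q ∷ q-path , ∈-∷⁺ʳ (here refl) (there ∘ q⊆p)

  record Split (p : Walk G u v) (x : Fin m) : Set where
    field
      left right  : Fin n
      before      : Walk G u left
      joins       : Joins G x left right
      after       : Walk G right v
      edges-split : edges G p ≡ edges G before ++ x ∷ edges G after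

  split : (p : Walk G u v) → x ∈ₗ edges G p → Split p x
  split (step e j p) (here refl) = record
    { before = [] ; joins = j ; after = p ; edges-split = refl }
  split (step e j p) (there x∈p) = record
    { before = step e j before ; joins = joins ; after = after
    ; edges-split = cong (e ∷_) edges-split }
    where open Split (split p x∈p)

  module _ {p : Walk G u v} (s : Split p x) where
    open Split s

    split-All : ∀ {P : Fin m → Set} → All P (edges G p) →
                All P (edges G before) × P x × All P (edges G after)
    split-All {P} Pp with Allₚ.++⁻ (edges G before) (subst (All P) edges-split Pp)
    ... | P-before , Px ∷ P-after = P-before , Px , P-after

    split-IsPath : IsPath G p → x ∉ₗ edges G before × x ∉ₗ edges G after
    split-IsPath p-path =
      Unique-middle⁻ (edges G before) (subst Unique edges-split (IsPath⇒Unique-edges p p-path))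

  Within-∪⁅⁆ : (p : Walk G u v) → Within G (S ∪ ⁅ e ⁆) p → e ∉ₗ edges G p → Within G S p
  Within-∪⁅⁆ p p-within e∉p = All.tabulate λ x∈p →
    ∈-∪⁅⁆⁻ (All.lookup p-within x∈p) (λ { refl → e∉p x∈p })

  Within-remove⁻ : (p : Walk G u v) → Within G (S - e) p → Within G S p × e ∉ₗ edges G p
  Within-remove⁻ {S = S} {e} p p-within =
    All.map (p─q⊆p S ⁅ e ⁆) p-within ,
    λ e∈p → x∈p─q⇒x∉q (All.lookup p-within e∈p) (x∈⁅x⁆ e)

  acyclic⇒bridge : Acyclic G S → e ∈ S → Joins G e u w → (c : Walk G w u) → Within G S c →
                   e ∈ₗ edges G c
  acyclic⇒bridge {e = e} acyclic e∈S j c c-within with reorient (Joins-sym j) Joins-src-tgt c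
  ... | c′ , c′⊆c with walk⇒path c′ | e ∈? edges G c
  ...   | _                  | yes e∈c = e∈c
  ...   | q , q-path , q⊆c′ | no  e∉c =
    contradiction (e , e∈S , q , q-path , anti-mono q⊆c c-within , e∉c ∘ q⊆c) acyclic
    where
      q⊆c : edges G q ⊆ₗ edges G c
      q⊆c = c′⊆c ∘ q⊆c′

  edge-on-parallel-walk : Acyclic G S → x ∈ S → Joins G x w w′ →
    ∀ {u v} (a : Walk G u w) (b : Walk G w′ v) (q : Walk G u v) →
    Within G S a → Within G S b → Within G S q →
    x ∈ₗ edges G q ⊎ x ∈ₗ edges G a ⊎ x ∈ₗ edges G b
  edge-on-parallel-walk acyclic x∈S j a b q a-within b-within q-within
    with ∈-++ᵂ⁻ b (acyclic⇒bridge acyclic x∈S j (b ++ᵂ reverse q ++ᵂ a)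
           (Within-++ᵂ b-within (Within-++ᵂ (Within-reverse q q-within) a-within)))
  ... | inj₁ x∈b = inj₂ (inj₂ x∈b)
  ... | inj₂ x∈q⁻¹a = Sum.map (∈-reverse⁻ q) inj₁ (∈-++ᵂ⁻ (reverse q) x∈q⁻¹a)

  path⊆walk : Acyclic G S → (p q : Walk G u v) → IsPath G p → Within G S p → Within G S q →
              edges G p ⊆ₗ edges G q
  path⊆walk acyclic p q p-path p-within q-within x∈p =
    let s = split p x∈p
        open Split s
        (a-within , x∈S , b-within) = split-All s p-within
        (x∉a , x∉b) = split-IsPath s p-path
    in [ id , [ (λ x∈a → contradiction x∈a x∉a) , (λ x∈b → contradiction x∈b x∉b) ] ]
         (edge-on-parallel-walk acyclic x∈S joins before after q a-within b-within q-within)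

  module Exchange (T : Subset m) (T-acyclic : Acyclic G T) {ij : Fin m}
                  (C : Walk G (src ij) (tgt ij)) (C-path : IsPath G C) (C-within : Within G T C)
                  where

    detour : (p : Walk G u v) → Within G (T ∪ ⁅ ij ⁆) p →
             Σ (Walk G u v) λ p′ → Within G T p′ × edges G p′ ⊆ₗ edges G p ++ edges G C
    detour []           _               = [] , [] , λ ()
    detour (step e j p) (e∈ ∷ p-within) with detour p p-within | x∈p∪q⁻ T ⁅ ij ⁆ e∈
    ... | p′ , p′-within , p′⊆ | inj₁ e∈T =
      step e j p′ , e∈T ∷ p′-within , ∈-∷⁺ʳ (here refl) (there ∘ p′⊆)
    ... | p′ , p′-within , p′⊆ | inj₂ e∈⁅ij⁆ with x∈⁅y⁆⇒x≡y ij e∈⁅ij⁆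
    ...   | refl =
      let (C′ , C′⊆C) = reorient Joins-src-tgt j C in
      C′ ++ᵂ p′ , Within-++ᵂ (anti-mono C′⊆C C-within) p′-within ,
      [ ∈-++⁺ʳ (ij ∷ edges G p) ∘ C′⊆C , there ∘ p′⊆ ] ∘ ∈-++ᵂ⁻ C′

    path-edge-on-walk-or-C : (p q : Walk G u v) → IsPath G p → Within G (T ∪ ⁅ ij ⁆) p →
                             Within G T q → x ∈ₗ edges G p → x ≢ ij →
                             x ∈ₗ edges G q ⊎ x ∈ₗ edges G C
    path-edge-on-walk-or-C p q p-path p-within q-within x∈p x≢ij =
      let s = split p x∈p
          open Split s
          (a-within , x∈T∪ij , b-within) = split-All s p-within
          (x∉a , x∉b) = split-IsPath s p-path
          (a′ , a′-within , a′⊆) = detour before a-within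
          (b′ , b′-within , b′⊆) = detour after b-within
      in Sum.map₂ [ (λ x∈a′ → ∈-++⁻ʳ-∉ (edges G before) (a′⊆ x∈a′) x∉a)
                  , (λ x∈b′ → ∈-++⁻ʳ-∉ (edges G after) (b′⊆ x∈b′) x∉b) ]
           (edge-on-parallel-walk T-acyclic (∈-∪⁅⁆⁻ x∈T∪ij x≢ij) joins a′ b′ q
              a′-within b′-within q-within)

    cycle-edge-on-walk : ∀ {r : Fin m} → r ∈ₗ edges G C → (p q : Walk G u v) → IsPath G p →
                         Within G ((T - r) ∪ ⁅ ij ⁆) p → ij ∈ₗ edges G p → Within G T q →
                         r ∈ₗ edges G q
    cycle-edge-on-walk {r = r} r∈C p q p-path p-within ij∈p q-within =
      let s = split p ij∈p
          open Split s
          (a-within , _ , b-within) = split-All s p-within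
          (ij∉a , ij∉b) = split-IsPath s p-path
          (a-in-T , r∉a) = Within-remove⁻ {S = T} before (Within-∪⁅⁆ before a-within ij∉a)
          (b-in-T , r∉b) = Within-remove⁻ {S = T} after (Within-∪⁅⁆ after b-within ij∉b)
          c = reverse before ++ᵂ q ++ᵂ reverse after
          c-within = Within-++ᵂ (Within-reverse before a-in-T)
                       (Within-++ᵂ q-within (Within-reverse after b-in-T))
          (c′ , c′⊆c) = reorient joins Joins-src-tgt c
          r∈c = c′⊆c (path⊆walk T-acyclic C c′ C-path C-within (anti-mono c′⊆c c-within) r∈C)
      in [ (λ r∈a⁻¹ → contradiction (∈-reverse⁻ before r∈a⁻¹) r∉a)
         , [ id , (λ r∈b⁻¹ → contradiction (∈-reverse⁻ after r∈b⁻¹) r∉b) ] ∘ ∈-++ᵂ⁻ q ]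
         (∈-++ᵂ⁻ (reverse before) r∈c)

    exchanged-path-edge : ∀ {r : Fin m} → r ∈ₗ edges G C → (P′ P : Walk G u v) → IsPath G P′ →
                          Within G ((T - r) ∪ ⁅ ij ⁆) P′ → Within G T P →
                          x ∈ₗ edges G P′ → x ≢ ij →
                          x ∈ₗ edges G P ⊎ (x ∈ₗ edges G C × r ∈ₗ edges G P)
    exchanged-path-edge {r = r} r∈C P′ P P′-path P′-within P-within x∈P′ x≢ij with ij ∈? edges G P′
    ... | no ij∉P′ =
      inj₁ (path⊆walk T-acyclic P′ P P′-path
              (proj₁ (Within-remove⁻ P′ (Within-∪⁅⁆ P′ P′-within ij∉P′))) P-within x∈P′)
    ... | yes ij∈P′ =
      Sum.map₂ (_, cycle-edge-on-walk r∈C P′ P P′-path P′-within ij∈P′ P-within)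
        (path-edge-on-walk-or-C P′ P P′-path (All.map T′⊆T∪ij P′-within) P-within x∈P′ x≢ij)
      where
        T′⊆T∪ij : ∀ {y} → y ∈ (T - r) ∪ ⁅ ij ⁆ → y ∈ T ∪ ⁅ ij ⁆
        T′⊆T∪ij = x∈p∪q⁺ ∘ Sum.map₁ (p─q⊆p T ⁅ r ⁆) ∘ x∈p∪q⁻ (T - r) ⁅ ij ⁆

proposition2 : ∀ {c ℓ₁ ℓ₂ : Level} (G : Graph) (O : OrderedAbelianGroup c ℓ₁ ℓ₂)
    (cost : Fin (Graph.m G) → OrderedAbelianGroup.Carrier O) →
    ConnectedGraph G →
    (T : Subset (Graph.m G)) → Costs.IsMST G O cost T →
    (ij : Fin (Graph.m G)) → ij ∉ T →
    (r : Fin (Graph.m G)) → Costs.IsREdge G O cost T ⊥ ij r →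
    (kl : Fin (Graph.m G)) → kl ∉ T → kl ≢ ij →
    ∀ x y →
    Costs.HasRCost G O cost ((T - r) ∪ ⁅ ij ⁆) ⁅ ij ⁆ kl x →
    Costs.HasRCost G O cost T ⊥ kl y →
    Costs._≤ₑ_ G O cost y x
proposition2 G O cost _ T ((_ , T-acyclic) , _) ij _ r (C , C-path , C-within , r∈C , _ , r-max)
             kl _ _ x y = compare
  where
    open Graph G using (loopless)
    open WalkProperties G
    open Exchange T T-acyclic C C-path C-within
    open Costs G O cost
    open OrderedAbelianGroupProperties O using (⊖-monoʳ-≤; ≤-trans)

    compare : HasRCost ((T - r) ∪ ⁅ ij ⁆) ⁅ ij ⁆ kl x → HasRCost T ⊥ kl y → y ≤ₑ x
    compare _ (infinite P _ _ P-within-⊥) = ⊥-elim (loopless kl (Within⊥⇒≡ P P-within-⊥))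
    compare (infinite _ _ _ _) (finite _ _) = ≤∞
    compare (finite r′ (P′ , P′-path , P′-within , r′∈P′ , r′∉⁅ij⁆ , _))
            (finite r″ (P , _ , P-within , _ , _ , r″-max)) =
      fin≤fin (⊖-monoʳ-≤ (cost kl)
        ([ (λ r′∈P → r″-max r′ r′∈P ∉⊥)
         , (λ (r′∈C , r∈P) → ≤-trans (r-max r′ r′∈C ∉⊥) (r″-max r r∈P ∉⊥)) ]
         (exchanged-path-edge r∈C P′ P P′-path P′-within P-within r′∈P′
            (λ { refl → r′∉⁅ij⁆ (x∈⁅x⁆ ij) }))))
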